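{- Let $G=(\mathfrak{N},\mathfrak{T},\mathfrak{R},\mathfrak{S})$ be a context-free grammar, $\Sigma$ a set of characters, $(\textsl{Lex},\textsl{Sel})$ a local lexing with respect to $\mathfrak{T}$ and $\Sigma$, and $D\in\Sigma^*$. Let $\mathfrak{I}$ be the item set computed by Earley's algorithm with local lexing on input $D$ (defined in the context). Then \[ D\in\mathcal{L}_\Sigma \quad\text{iff}\quad \exists\,\alpha.\ (\mathfrak{S}\rightarrow\alpha\,\bullet,\,0,\,|D|)\in\mathfrak{I}. \]
   Context: Notation: for a set $U$, $U^*$ is the set of finite sequences over $U$, $\varepsilon$ the empty sequence, juxtaposition is concatenation, $|\alpha|$ is the length and $\alpha_i$ ($0\le i<|\alpha|$) the $i$-th element. A context-free grammar $(\mathfrak{N},\mathfrak{T},\mathfrak{R},\mathfrak{S})$ has disjoint nonterminals $\mathfrak{N}$ and terminals $\mathfrak{T}$, rules $\mathfrak{R}\subseteq\mathfrak{N}\times(\mathfrak{N}\cup\mathfrak{T})^*$ (written $N\rightarrow\alpha$), start symbol $\mathfrak{S}\in\mathfrak{N}$; $\Rightarrow$ is one-step derivation and $\overset{*}{\Rightarrow}$ its reflexive transitive closure. $\mathcal{L}=\{w\in\mathfrak{T}^*\mid \mathfrak{S}\overset{*}{\Rightarrow}w\}$ and $\mathcal{L}_{\text{prefix}}=\{w\in\mathfrak{T}^*\mid \exists\alpha\in(\mathfrak{N}\cup\mathfrak{T})^*.\ \mathfrak{S}\overset{*}{\Rightarrow}w\alpha\}$. Tokens: a token is a pair $x=(t,c)\in\mathfrak{T}\times\Sigma^*$;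 write $[x]=t$, $\overline{x}=c$, and for a token sequence (path) $q=x_0\ldots x_r$, $[q]=[x_0]\ldots[x_r]$ and $\overline{q}=\overline{x_0}\ldots\overline{x_r}$. A local lexing is a pair $(\textsl{Lex},\textsl{Sel})$ where: $\textsl{Lex}$ assigns to each $t\in\mathfrak{T}$ a function $\textsl{Lex}(t)$ which, given $D\in\Sigma^*$ and $k\in\{0,\ldots,|D|\}$, returns a set of tokens of the form $(t,c)$ with $k+|c|\le|D|$ and $c_i=D_{k+i}$ for $0\le i\le |c|-1$; and $\textsl{Sel}$ takes token sets $A\subseteq B$ and returns a token set with $A\subseteq\textsl{Sel}(A,B)\subseteq B$. Local lexing semantics for input $D$: let $\operatorname{limit} f\, X=\bigcup_{n\ge0}f^n(X)$. Let $\mathcal{X}_k=\{x\in\mathfrak{T}\times\Sigma^*\mid x\in\textsl{Lex}([x])(D,k)\}$ and $\operatorname{Append}_k\,T\,P=P\cup\{pt\mid p\in P,\ |\overline{p}|=k,\ t\in T,\ [pt]\in\mathcal{L}_{\text{prefix}}\}$. Define recursively for $k\in\{0,\ldots,|D|\}$, $u\ge0$: $\mathcal{P}_0^0=\{\varepsilon\}$; $\mathcal{W}_k^u=\{x\in\mathcal{X}_k\mid\exists p\in\mathcal{P}_k^u.\ |\overline{p}|=k\wedge[px]\in\mathcal{L}_{\text{prefix}}\}$; $\mathcal{Z}_k^0=\emptyset$; $\mathcal{Z}_k^{u+1}=\textsl{Sel}(\mathcal{Z}_k^u,\mathcal{W}_k^u)$; $\mathcal{P}_k^{u+1}=\operatorname{limit}(\operatorname{Append}_k\,\mathcal{Z}_k^{u+1})\,\mathcal{P}_k^u$;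 $\mathcal{P}_k^\infty=\bigcup_{u}\mathcal{P}_k^u$; $\mathcal{P}_{k+1}^0=\mathcal{P}_k^\infty$. Put $\mathfrak{P}=\mathcal{P}_{|D|}^\infty$, $\ell\ell(D)=\{p\in\mathfrak{P}\mid|\overline{p}|=|D|\wedge[p]\in\mathcal{L}\}$ and the character language $\mathcal{L}_\Sigma=\{D\in\Sigma^*\mid\ell\ell(D)\neq\emptyset\}$. Earley's algorithm with local lexing on input $D$: an item is $(N\rightarrow\alpha\bullet\beta,i,j)$ with $(N\rightarrow\alpha\beta)\in\mathfrak{R}$, $0\le i\le j\le|D|$. For an item set $I$, token set $T$, position $k$: $\operatorname{Init}=\{(\mathfrak{S}\rightarrow\bullet\alpha,0,0)\mid \mathfrak{S}\rightarrow\alpha\in\mathfrak{R}\}$; $\operatorname{Predict}\,k\,I=I\cup\{(M\rightarrow\bullet\gamma,k,k)\mid\exists N,\alpha,\beta,i.\ (N\rightarrow\alpha\bullet M\beta,i,k)\in I\wedge (M\rightarrow\gamma)\in\mathfrak{R}\}$; $\operatorname{Complete}\,k\,I=I\cup\{(N\rightarrow\alpha M\bullet\beta,i,k)\mid\exists j,\gamma.\ (N\rightarrow\alpha\bullet M\beta,i,j)\in I\wedge(M\rightarrow\gamma\bullet,j,k)\in I\}$; $\operatorname{Scan}\,T\,k\,I=I\cup\{(N\rightarrow\alpha X\bullet\beta,i,k+|c|)\mid (X,c)\in T\wedge(N\rightarrow\alpha\bullet X\beta,i,k)\in I\}$; $\operatorname{Tokens}\,T\,k\,I=\textsl{Sel}(T,\{x\mid\exists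 X,N,\alpha,\beta,i.\ X\in\mathfrak{T}\wedge(N\rightarrow\alpha\bullet X\beta,i,k)\in I\wedge x\in\textsl{Lex}(X)(D,k)\})$; $\pi_k\,T\,I=\operatorname{limit}(\operatorname{Scan}\,T\,k\circ\operatorname{Complete}\,k\circ\operatorname{Predict}\,k)\,I$. Then: $\mathcal{J}_0^0=\pi_0\,\emptyset\,\operatorname{Init}$; $\mathcal{T}_k^0=\emptyset$; $\mathcal{T}_k^{u+1}=\operatorname{Tokens}\,\mathcal{T}_k^u\,k\,\mathcal{J}_k^u$; $\mathcal{J}_k^{u+1}=\pi_k\,\mathcal{T}_k^{u+1}\,\mathcal{J}_k^u$; $\mathcal{I}_k=\bigcup_u\mathcal{J}_k^u$; $\mathcal{J}_{k+1}^0=\pi_{k+1}\,\emptyset\,\mathcal{I}_k$; and $\mathfrak{I}=\mathcal{I}_{|D|}$. -}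

module Defs where

open import Level using (0ℓ)
open import Data.Nat using (ℕ; zero; suc; _+_; _≤_)
open import Data.List using (List; []; _∷_; _++_; map; concatMap; length; drop; [_])
open import Data.Product using (Σ; ∃; ∃-syntax; _×_; _,_; proj₁; proj₂)
open import Data.Sum using (_⊎_; inj₁; inj₂)
open import Data.Empty using (⊥)
open import Function using (_∘_; _⇔_)
open import Relation.Unary using (Pred; _⊆_; _∈_)
open import Relation.Binary.PropositionalEquality using (_≡_)
open import Relation.Binary.Construct.Closure.ReflexiveTransitive using (Star)

iter : {X : Set} → (Pred X 0ℓ → Pred X 0ℓ) → ℕ → Pred X 0ℓ → Pred X 0ℓ
iter f zero    A = A
iter f (suc n) A = f (iter f n A)

limit : {X : Set} → (Pred X 0ℓ → Pred X 0ℓ) → Pred X 0ℓ → Pred X 0ℓ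
limit f A x = ∃[ n ] iter f n A x

∅ : {X : Set} → Pred X 0ℓ
∅ _ = ⊥

record Grammar : Set₁ where
  field
    NT    : Set
    Te    : Set                          -- terminals 𝔗 (disjoint from 𝔑 via ⊎)
    Rule  : NT → List (NT ⊎ Te) → Set    -- ℜ, as a relation: Rule N α  ⇔  N → α ∈ ℜ
    Start : NT

  Sym : Set
  Sym = NT ⊎ Te

  data _⇒_ : List Sym → List Sym → Set where
    step : ∀ u N γ v → Rule N γ → (u ++ inj₁ N ∷ v) ⇒ (u ++ γ ++ v)

  _⇒*_ : List Sym → List Sym → Set
  _⇒*_ = Star _⇒_

  terms : List Te → List Sym
  terms = map inj₂

  L : Pred (List Te) 0ℓ
  L w = [ inj₁ Start ] ⇒* terms w

  Lprefix : Pred (List Te) 0ℓ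
  Lprefix w = ∃[ α ] ([ inj₁ Start ] ⇒* (terms w ++ α))

module _ (Te Ch : Set) where

  Token : Set
  Token = Te × List Ch

  record LocalLexing : Set₁ where
    field
      Lex : Te → List Ch → ℕ → Pred Token 0ℓ
      Lex-ok : ∀ t D k x → x ∈ Lex t D k →
               proj₁ x ≡ t × k + length (proj₂ x) ≤ length D
               × ∃[ r ] (drop k D ≡ proj₂ x ++ r)
      Sel : Pred Token 0ℓ → Pred Token 0ℓ → Pred Token 0ℓ
      Sel-ok : ∀ A B → A ⊆ B → (A ⊆ Sel A B) × (Sel A B ⊆ B)
      -- sets are predicates, so Sel is required to be a function of the
      -- *sets* A and B, i.e. to respect extensional equality of predicates
      Sel-ext : ∀ A A′ B B′ → (∀ x → A x ⇔ A′ x) → (∀ x → B x ⇔ B′ x) →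
                ∀ x → Sel A B x ⇔ Sel A′ B′ x

module LocalLexingSemantics {Ch : Set} (G : Grammar)
         (LL : LocalLexing (Grammar.Te G) Ch) (D : List Ch) where
  open Grammar G
  open LocalLexing LL

  Tok : Set
  Tok = Token Te Ch

  Path : Set
  Path = List Tok

  ⌊_⌋ : Path → List Te
  ⌊ q ⌋ = map proj₁ q

  chars : Path → List Ch
  chars q = concatMap proj₂ q

  𝓧 : ℕ → Pred Tok 0ℓ
  𝓧 k x = x ∈ Lex (proj₁ x) D k

  Append : ℕ → Pred Tok 0ℓ → Pred Path 0ℓ → Pred Path 0ℓ
  Append k T P q = P q ⊎
    ∃[ p ] ∃[ t ] (P p × length (chars p) ≡ k × T t
                   × Lprefix ⌊ p ++ [ t ] ⌋ × q ≡ p ++ [ t ])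

  mutual
    𝓟 : ℕ → ℕ → Pred Path 0ℓ
    𝓟 zero    zero    q = q ≡ []
    𝓟 (suc k) zero    q = 𝓟∞ k q
    𝓟 k       (suc u)   = limit (Append k (𝓩 k (suc u))) (𝓟 k u)

    𝓟∞ : ℕ → Pred Path 0ℓ
    𝓟∞ k q = ∃[ u ] 𝓟 k u q

    𝓦 : ℕ → ℕ → Pred Tok 0ℓ
    𝓦 k u x = 𝓧 k x × ∃[ p ] (𝓟 k u p × length (chars p) ≡ k × Lprefix ⌊ p ++ [ x ] ⌋)

    𝓩 : ℕ → ℕ → Pred Tok 0ℓ
    𝓩 k zero    = ∅
    𝓩 k (suc u) = Sel (𝓩 k u) (𝓦 k u)

  𝔓 : Pred Path 0ℓ
  𝔓 = 𝓟∞ (length D)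

  ℓℓ : Pred Path 0ℓ
  ℓℓ p = 𝔓 p × length (chars p) ≡ length D × L ⌊ p ⌋

  -- D ∈ 𝓛_Σ  (ℓℓ(D) ≠ ∅, read as: ℓℓ(D) is inhabited)
  InCharLang : Set
  InCharLang = ∃[ p ] ℓℓ p

  record Item : Set where
    constructor item
    field
      lhs  : NT
      α β  : List Sym
      i j  : ℕ

  Init : Pred Item 0ℓ
  Init x = ∃[ γ ] (Rule Start γ × x ≡ item Start [] γ 0 0)

  Predict : ℕ → Pred Item 0ℓ → Pred Item 0ℓ
  Predict k I x = I x ⊎
    ∃[ N ] ∃[ α ] ∃[ M ] ∃[ β ] ∃[ i ] ∃[ γ ]
      (I (item N α (inj₁ M ∷ β) i k) × Rule M γ × x ≡ item M [] γ k k)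

  Complete : ℕ → Pred Item 0ℓ → Pred Item 0ℓ
  Complete k I x = I x ⊎
    ∃[ N ] ∃[ α ] ∃[ M ] ∃[ β ] ∃[ i ] ∃[ j ] ∃[ γ ]
      (I (item N α (inj₁ M ∷ β) i j) × I (item M γ [] j k)
       × x ≡ item N (α ++ [ inj₁ M ]) β i k)

  Scan : Pred Tok 0ℓ → ℕ → Pred Item 0ℓ → Pred Item 0ℓ
  Scan T k I x = I x ⊎
    ∃[ X ] ∃[ c ] ∃[ N ] ∃[ α ] ∃[ β ] ∃[ i ]
      (T (X , c) × I (item N α (inj₂ X ∷ β) i k)
       × x ≡ item N (α ++ [ inj₂ X ]) β i (k + length c))

  Tokens : Pred Tok 0ℓ → ℕ → Pred Item 0ℓ → Pred Tok 0ℓ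
  Tokens T k I = Sel T (λ x → ∃[ X ] ∃[ N ] ∃[ α ] ∃[ β ] ∃[ i ]
                        (I (item N α (inj₂ X ∷ β) i k) × x ∈ Lex X D k))

  π : ℕ → Pred Tok 0ℓ → Pred Item 0ℓ → Pred Item 0ℓ
  π k T = limit (Scan T k ∘ Complete k ∘ Predict k)

  mutual
    𝓙 : ℕ → ℕ → Pred Item 0ℓ
    𝓙 zero    zero    = π 0 ∅ Init
    𝓙 (suc k) zero    = π (suc k) ∅ (𝓘 k)
    𝓙 k       (suc u) = π k (𝓣 k (suc u)) (𝓙 k u)

    𝓣 : ℕ → ℕ → Pred Tok 0ℓ
    𝓣 k zero    = ∅
    𝓣 k (suc u) = Tokens (𝓣 k u) k (𝓙 k u)

    𝓘 : ℕ → Pred Item 0ℓ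
    𝓘 k x = ∃[ u ] 𝓙 k u x

  𝔍 : Pred Item 0ℓ
  𝔍 = 𝓘 (length D)

-- Earley's token set 𝓣 k u and the semantic token set 𝓩 k u are both
-- obtained by applying Sel to a candidate set of stage u, so they agree as
-- soon as the candidate sets do. A token is an Earley candidate iff some item
-- ending at k expects its terminal, and a semantic candidate iff it extends
-- some path of 𝓟 k u ending at k. While the token sets agree up to (k, u),
-- the paths of 𝓟 k u are exactly the prefix-valid token sequences whose
-- tokens were selected at their start positions; every item of 𝓙 k u is
-- witnessed by such a path, and walking a parse tree of such a path along its
-- tokens reaches the corresponding items. Hence the candidate sets coincide,
-- and induction on (k, u) gives 𝓣 = 𝓩 everywhere; the theorem is the same
-- soundness and completeness at k = |D| for complete derivations from 𝔖.
module Submission where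

open import Level using (0ℓ)
open import Defs
open import Data.Nat using (ℕ; zero; suc; _+_; _≤_; _<_; _≤′_; ≤′-refl; ≤′-step; z≤n; s≤s)
open import Data.Nat.Properties
open import Data.List using (List; []; _∷_; _++_; _∷ʳ_; length; map; [_])
open import Data.List.Properties using (++-assoc; ++-identityʳ; length-++; map-++; concatMap-++; ∷-injective)
open import Data.List.Reverse using (Reverse; reverseView; []; _∶_∶ʳ_)
open import Data.Product using (∃-syntax; _×_; _,_; proj₁; proj₂)
open import Data.Sum using (_⊎_; inj₁; inj₂)
open import Data.Empty using (⊥-elim)
open import Function using (_∘_)
open import Function.Bundles using (_⇔_; mk⇔; Equivalence)
open import Relation.Nullary using (yes; no)
open import Relation.Unary using (Pred; _⊆_; _∈_)
open import Relation.Binary.PropositionalEquality hiding ([_])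
open import Relation.Binary.Construct.Closure.ReflexiveTransitive using (ε; _◅_; _◅◅_)

≡⇒⊆ : {X : Set} {P Q : Pred X 0ℓ} → P ≡ Q → P ⊆ Q
≡⇒⊆ refl h = h

module _ {X : Set} {P : ℕ → Pred X 0ℓ} (P-step : ∀ {u} → P u ⊆ P (suc u)) where

  chain-mono : ∀ {u v} → u ≤ v → P u ⊆ P v
  chain-mono {u} u≤v = go (≤⇒≤′ u≤v)
    where
    go : ∀ {v} → u ≤′ v → P u ⊆ P v
    go ≤′-refl         h = h
    go (≤′-step u≤′v) h = P-step (go u≤′v h)

module _ {A B : Set} where

  map-++⁻ : ∀ (f : A → B) xs ys {zs} → map f xs ≡ ys ++ zs →
            ∃[ xs₁ ] ∃[ xs₂ ] (xs ≡ xs₁ ++ xs₂ × map f xs₁ ≡ ys × map f xs₂ ≡ zs)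
  map-++⁻ f xs       []       e = [] , xs , refl , refl , e
  map-++⁻ f []       (y ∷ ys) ()
  map-++⁻ f (x ∷ xs) (y ∷ ys) e with ∷-injective e
  ... | refl , e′ with map-++⁻ f xs ys e′
  ... | xs₁ , xs₂ , refl , refl , refl = x ∷ xs₁ , xs₂ , refl , refl , refl

module _ {A : Set} where

  ++-≡-++∷⁻ : ∀ (xs ys as : List A) {y bs} → xs ++ ys ≡ as ++ y ∷ bs →
              (∃[ cs ] xs ≡ as ++ y ∷ cs) ⊎ (∃[ cs ] (as ≡ xs ++ cs × ys ≡ cs ++ y ∷ bs))
  ++-≡-++∷⁻ []       ys as       e    = inj₂ (as , refl , e)
  ++-≡-++∷⁻ (x ∷ xs) ys []       refl = inj₁ (xs , refl)
  ++-≡-++∷⁻ (x ∷ xs) ys (a ∷ as) e with ∷-injective e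
  ... | refl , e′ with ++-≡-++∷⁻ xs ys as e′
  ...   | inj₁ (cs , refl)     = inj₁ (cs , refl)
  ...   | inj₂ (cs , refl , e″) = inj₂ (cs , refl , e″)

module Derivations (G : Grammar) where
  open Grammar G

  ⇒-inContext : ∀ u v {a b} → a ⇒ b → (u ++ a ++ v) ⇒ (u ++ b ++ v)
  ⇒-inContext u v (step u′ N γ v′ R) = subst₂ _⇒_ e₁ e₂ (step (u ++ u′) N γ (v′ ++ v) R)
    where
    e₁ : (u ++ u′) ++ inj₁ N ∷ v′ ++ v ≡ u ++ (u′ ++ inj₁ N ∷ v′) ++ v
    e₁ = trans (++-assoc u u′ _) (cong (u ++_) (sym (++-assoc u′ (inj₁ N ∷ v′) v)))
    e₂ : (u ++ u′) ++ γ ++ v′ ++ v ≡ u ++ (u′ ++ γ ++ v′) ++ v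
    e₂ = trans (++-assoc u u′ _)
           (cong (u ++_) (trans (cong (u′ ++_) (sym (++-assoc γ v′ v))) (sym (++-assoc u′ (γ ++ v′) v))))

  ⇒*-inContext : ∀ u v {a b} → a ⇒* b → (u ++ a ++ v) ⇒* (u ++ b ++ v)
  ⇒*-inContext u v ε        = ε
  ⇒*-inContext u v (s ◅ ss) = ⇒-inContext u v s ◅ ⇒*-inContext u v ss

  ⇒*-++ʳ : ∀ v {a b} → a ⇒* b → (a ++ v) ⇒* (b ++ v)
  ⇒*-++ʳ = ⇒*-inContext []

  ⇒*-++ˡ : ∀ u {a b} → a ⇒* b → (u ++ a) ⇒* (u ++ b)
  ⇒*-++ˡ u {a} {b} d =
    subst₂ (λ a′ b′ → (u ++ a′) ⇒* (u ++ b′)) (++-identityʳ a) (++-identityʳ b) (⇒*-inContext u [] d)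

  ⇒*-++ : ∀ {a a′ b b′} → a ⇒* a′ → b ⇒* b′ → (a ++ b) ⇒* (a′ ++ b′)
  ⇒*-++ {a′ = a′} {b = b} d₁ d₂ = ⇒*-++ʳ b d₁ ◅◅ ⇒*-++ˡ a′ d₂

  ⇒*-rule : ∀ {N γ} → Rule N γ → [ inj₁ N ] ⇒* γ
  ⇒*-rule {N} {γ} R = subst ([ inj₁ N ] ⇒*_) (++-identityʳ γ) (step [] N γ [] R ◅ ε)

  -- Forest β g: one derivation tree per symbol of β (a symbol may stay a
  -- leaf), with frontier g.
  data Forest : List Sym → List Sym → Set where
    []   : Forest [] []
    leaf : ∀ s {β g} → Forest β g → Forest (s ∷ β) (s ∷ g)
    node : ∀ {N ρ β g₁ g₂} → Rule N ρ → Forest ρ g₁ → Forest β g₂ → Forest (inj₁ N ∷ β) (g₁ ++ g₂)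

  Forest-refl : ∀ g → Forest g g
  Forest-refl []      = []
  Forest-refl (s ∷ g) = leaf s (Forest-refl g)

  Forest-++ : ∀ {a b g₁ g₂} → Forest a g₁ → Forest b g₂ → Forest (a ++ b) (g₁ ++ g₂)
  Forest-++ []          t = t
  Forest-++ (leaf s ta) t = leaf s (Forest-++ ta t)
  Forest-++ {g₂ = g₂} (node {g₁ = h₁} {g₂ = h₂} R tρ ta) t =
    subst (Forest _) (sym (++-assoc h₁ h₂ g₂)) (node R tρ (Forest-++ ta t))

  Forest-++⁻ : ∀ a {b g} → Forest (a ++ b) g → ∃[ g₁ ] ∃[ g₂ ] (g ≡ g₁ ++ g₂ × Forest a g₁ × Forest b g₂)
  Forest-++⁻ []      t = [] , _ , refl , [] , t
  Forest-++⁻ (s ∷ a) (leaf .s t) with Forest-++⁻ a t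
  ... | g₁ , g₂ , refl , ta , tb = s ∷ g₁ , g₂ , refl , leaf s ta , tb
  Forest-++⁻ (.(inj₁ _) ∷ a) (node {g₁ = h} R tρ t) with Forest-++⁻ a t
  ... | g₁ , g₂ , refl , ta , tb = h ++ g₁ , g₂ , sym (++-assoc h g₁ g₂) , node R tρ ta , tb

  Forest-⇒ : ∀ {β β′ g} → β ⇒ β′ → Forest β′ g → Forest β g
  Forest-⇒ (step u N ρ v R) t with Forest-++⁻ u t
  ... | _ , _ , refl , tu , t′ with Forest-++⁻ ρ t′
  ...   | _ , _ , refl , tρ , tv = Forest-++ tu (node R tρ tv)

  ⇒*⇒Forest : ∀ {β γ} → β ⇒* γ → Forest β γ
  ⇒*⇒Forest ε        = Forest-refl _
  ⇒*⇒Forest (s ◅ ss) = Forest-⇒ s (⇒*⇒Forest ss)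

module Correctness {Ch : Set} (G : Grammar) (LL : LocalLexing (Grammar.Te G) Ch) (D : List Ch) where
  open Grammar G
  open LocalLexing LL
  open LocalLexingSemantics G LL D
  open Derivations G

  S₀ : List Sym
  S₀ = [ inj₁ Start ]

  tsyms : Path → List Sym
  tsyms q = terms ⌊ q ⌋

  tlen : Tok → ℕ
  tlen x = length (proj₂ x)

  len : Path → ℕ
  len q = length (chars q)

  ⌊⌋-++ : ∀ a b → ⌊ a ++ b ⌋ ≡ ⌊ a ⌋ ++ ⌊ b ⌋
  ⌊⌋-++ = map-++ proj₁

  tsyms-++ : ∀ a b → tsyms (a ++ b) ≡ tsyms a ++ tsyms b
  tsyms-++ a b = trans (cong terms (⌊⌋-++ a b)) (map-++ inj₂ ⌊ a ⌋ ⌊ b ⌋)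

  tsyms-++⁻ : ∀ q g₁ {g₂} → tsyms q ≡ g₁ ++ g₂ →
              ∃[ q₁ ] ∃[ q₂ ] (q ≡ q₁ ++ q₂ × tsyms q₁ ≡ g₁ × tsyms q₂ ≡ g₂)
  tsyms-++⁻ q g₁ e with map-++⁻ inj₂ ⌊ q ⌋ g₁ e
  ... | w₁ , _ , e⌊⌋ , refl , refl with map-++⁻ proj₁ q w₁ e⌊⌋
  ...   | q₁ , q₂ , refl , refl , refl = q₁ , q₂ , refl , refl , refl

  len-++ : ∀ a b → len (a ++ b) ≡ len a + len b
  len-++ a b = trans (cong length (concatMap-++ proj₂ a b)) (length-++ (chars a))

  +len-∷ : ∀ j x q → j + len (x ∷ q) ≡ j + tlen x + len q
  +len-∷ j x q = trans (cong (j +_) (length-++ (proj₂ x))) (sym (+-assoc j (tlen x) (len q)))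

  +len-++ : ∀ j a b → j + len (a ++ b) ≡ j + len a + len b
  +len-++ j a b = trans (cong (j +_) (len-++ a b)) (sym (+-assoc j (len a) (len b)))

  len-++-≤ : ∀ a b → len a ≤ len (a ++ b)
  len-++-≤ a b = subst (len a ≤_) (sym (len-++ a b)) (m≤m+n (len a) (len b))

  Lprefix-[] : Lprefix []
  Lprefix-[] = S₀ , ε

  Lprefix-++⁻ : ∀ w v → Lprefix (w ++ v) → Lprefix w
  Lprefix-++⁻ w v (α , d) =
    terms v ++ α , subst (S₀ ⇒*_) (trans (cong (_++ α) (map-++ inj₂ w v)) (++-assoc (terms w) (terms v) α)) d

  Lprefix-∷ʳ⁻ : ∀ p x → Lprefix ⌊ p ∷ʳ x ⌋ → Lprefix ⌊ p ⌋
  Lprefix-∷ʳ⁻ p x lp = Lprefix-++⁻ ⌊ p ⌋ [ proj₁ x ] (subst Lprefix (⌊⌋-++ p [ x ]) lp)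

  -- AllAt P j q: laid end to end from position j, each token of q satisfies
  -- P at its start position.
  data AllAt (P : ℕ → Tok → Set) : ℕ → Path → Set where
    []  : ∀ {j} → AllAt P j []
    _∷_ : ∀ {j x q} → P j x → AllAt P (j + tlen x) q → AllAt P j (x ∷ q)

  AllAt-++ : ∀ {P j} a {b} → AllAt P j a → AllAt P (j + len a) b → AllAt P j (a ++ b)
  AllAt-++ {P} {j} []      {b} []       ok = subst (λ i → AllAt P i b) (+-identityʳ j) ok
  AllAt-++ {P} {j} (x ∷ a) {b} (o ∷ oa) ok = o ∷ AllAt-++ a oa (subst (λ i → AllAt P i b) (+len-∷ j x a) ok)

  AllAt-++⁻ : ∀ {P j} a {b} → AllAt P j (a ++ b) → AllAt P j a × AllAt P (j + len a) b
  AllAt-++⁻ {P} {j} []      {b} ok = [] , subst (λ i → AllAt P i b) (sym (+-identityʳ j)) ok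
  AllAt-++⁻ {P} {j} (x ∷ a) {b} (o ∷ ok) with AllAt-++⁻ a ok
  ... | oa , ob = o ∷ oa , subst (λ i → AllAt P i b) (sym (+len-∷ j x a)) ob

  AllAt-map : ∀ {P Q : ℕ → Tok → Set} → (∀ {j x} → P j x → Q j x) → ∀ {j q} → AllAt P j q → AllAt Q j q
  AllAt-map f []       = []
  AllAt-map f (o ∷ ok) = f o ∷ AllAt-map f ok

  data Parse : List Sym → Path → Set where
    []      : Parse [] []
    term    : ∀ {β x q} → Parse β q → Parse (inj₂ (proj₁ x) ∷ β) (x ∷ q)
    nonterm : ∀ {N ρ β q₁ q₂} → Rule N ρ → Parse ρ q₁ → Parse β q₂ → Parse (inj₁ N ∷ β) (q₁ ++ q₂)

  -- ParseUntil β q Y: β ⇒* [q] Y …, with the branch of the derivation tree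
  -- leading to this occurrence of Y made explicit.
  data ParseUntil : List Sym → Path → Sym → Set where
    here : ∀ {β₁ β₂ q Y} → Parse β₁ q → ParseUntil (β₁ ++ Y ∷ β₂) q Y
    deep : ∀ {β₁ β₂ K ρ q₁ q₂ Y} → Parse β₁ q₁ → Rule K ρ → ParseUntil ρ q₂ Y →
           ParseUntil (β₁ ++ inj₁ K ∷ β₂) (q₁ ++ q₂) Y

  ParseUntil-term : ∀ {β x q Y} → ParseUntil β q Y → ParseUntil (inj₂ (proj₁ x) ∷ β) (x ∷ q) Y
  ParseUntil-term (here p)     = here (term p)
  ParseUntil-term (deep p R u) = deep (term p) R u

  ParseUntil-nonterm : ∀ {N ρ β q₁ q₂ Y} → Rule N ρ → Parse ρ q₁ → ParseUntil β q₂ Y →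
                       ParseUntil (inj₁ N ∷ β) (q₁ ++ q₂) Y
  ParseUntil-nonterm R p (here p′) = here (nonterm R p p′)
  ParseUntil-nonterm {q₁ = q₁} R p (deep {q₁ = r₁} {q₂ = r₂} p′ R′ u) =
    subst (λ q → ParseUntil _ q _) (++-assoc q₁ r₁ r₂) (deep (nonterm R p p′) R′ u)

  Forest⇒Parse : ∀ {β g} → Forest β g → ∀ q → g ≡ tsyms q → Parse β q
  Forest⇒Parse []         []      e    = []
  Forest⇒Parse (leaf s t) (x ∷ q) refl = term (Forest⇒Parse t q refl)
  Forest⇒Parse (node {g₁ = g₁} R t ts) q e with tsyms-++⁻ q g₁ (sym e)
  ... | q₁ , q₂ , refl , e₁ , e₂ = nonterm R (Forest⇒Parse t q₁ (sym e₁)) (Forest⇒Parse ts q₂ (sym e₂))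

  Forest⇒ParseUntil : ∀ {β g} → Forest β g → ∀ q Y γ → g ≡ tsyms q ++ Y ∷ γ → ParseUntil β q Y
  Forest⇒ParseUntil []         []      Y γ ()
  Forest⇒ParseUntil []         (x ∷ q) Y γ ()
  Forest⇒ParseUntil (leaf s t) []      Y γ refl = here {β₁ = []} []
  Forest⇒ParseUntil (leaf s t) (x ∷ q) Y γ refl = ParseUntil-term (Forest⇒ParseUntil t q Y γ refl)
  Forest⇒ParseUntil (node {g₁ = g₁} {g₂} R t ts) q Y γ e with ++-≡-++∷⁻ g₁ g₂ (tsyms q) e
  ... | inj₁ (γ′ , e₁) = deep {β₁ = []} [] R (Forest⇒ParseUntil t q Y γ′ e₁)
  ... | inj₂ (g′ , e₁ , e₂) with tsyms-++⁻ q g₁ e₁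
  ...   | q₁ , q₂ , refl , e₁′ , refl =
    ParseUntil-nonterm R (Forest⇒Parse t q₁ (sym e₁′)) (Forest⇒ParseUntil ts q₂ Y γ e₂)

  start-Parse : ∀ {g} → Forest S₀ g → ∀ p → g ≡ tsyms p → ∃[ ρ ] (Rule Start ρ × Parse ρ p)
  start-Parse (leaf _ _) []      ()
  start-Parse (leaf _ _) (_ ∷ _) ()
  start-Parse (node {ρ = ρ} {g₁ = g₁} R t []) p e =
    ρ , R , Forest⇒Parse t p (trans (sym (++-identityʳ g₁)) e)

  start-ParseUntil : ∀ {g} → Forest S₀ g → ∀ p X γ → g ≡ tsyms p ++ inj₂ X ∷ γ →
                     ∃[ ρ ] (Rule Start ρ × ParseUntil ρ p (inj₂ X))
  start-ParseUntil (leaf _ _) []      _ _ ()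
  start-ParseUntil (leaf _ _) (_ ∷ _) _ _ ()
  start-ParseUntil (node {ρ = ρ} {g₁ = g₁} R t []) p X γ e =
    ρ , R , Forest⇒ParseUntil t p (inj₂ X) γ (trans (sym (++-identityʳ g₁)) e)

  πstep : ℕ → Pred Tok 0ℓ → Pred Item 0ℓ → Pred Item 0ℓ
  πstep k T = Scan T k ∘ Complete k ∘ Predict k

  iter-mono : ∀ {k T I m n} → m ≤ n → iter (πstep k T) m I ⊆ iter (πstep k T) n I
  iter-mono = chain-mono (λ h → inj₁ (inj₁ (inj₁ h)))

  π-incl : ∀ {k T I} → I ⊆ π k T I
  π-incl h = 0 , h

  π-predict : ∀ {k T I N α M β i γ} → π k T I (item N α (inj₁ M ∷ β) i k) → Rule M γ →
              π k T I (item M [] γ k k)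
  π-predict {N = N} {α} {M} {β} {i} {γ} (n , h) R =
    suc n , inj₁ (inj₁ (inj₂ (N , α , M , β , i , γ , h , R , refl)))

  π-complete : ∀ {k T I N α M β i j γ} → π k T I (item N α (inj₁ M ∷ β) i j) → π k T I (item M γ [] j k) →
               π k T I (item N (α ++ [ inj₁ M ]) β i k)
  π-complete {N = N} {α} {M} {β} {i} {j} {γ} (m , h₁) (n , h₂) =
    suc (m + n) , inj₁ (inj₂ (N , α , M , β , i , j , γ ,
                              inj₁ (iter-mono (m≤m+n m n) h₁) , inj₁ (iter-mono (m≤n+m n m) h₂) , refl))

  π-scan : ∀ {k T I N α β i x} → π k T I (item N α (inj₂ (proj₁ x) ∷ β) i k) → T x →
           π k T I (item N (α ++ [ inj₂ (proj₁ x) ]) β i (k + tlen x))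
  π-scan {N = N} {α} {β} {i} {x} (n , h) t =
    suc n , inj₂ (proj₁ x , proj₂ x , N , α , β , i , t , inj₁ (inj₁ h) , refl)

  -- 𝓙 and 𝓟 are defined by matching on the position first, so their stage
  -- successor clauses only hold propositionally for a variable position.
  𝓙-suc : ∀ k u → 𝓙 k (suc u) ≡ π k (𝓣 k (suc u)) (𝓙 k u)
  𝓙-suc zero    u = refl
  𝓙-suc (suc k) u = refl

  𝓟-suc : ∀ k u → 𝓟 k (suc u) ≡ limit (Append k (𝓩 k (suc u))) (𝓟 k u)
  𝓟-suc zero    u = refl
  𝓟-suc (suc k) u = refl

  𝓙-is-π : ∀ k u → ∃[ I ] (𝓙 k u ≡ π k (𝓣 k u) I)
  𝓙-is-π zero    zero    = Init , refl
  𝓙-is-π (suc k) zero    = 𝓘 k , refl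
  𝓙-is-π k       (suc u) = 𝓙 k u , 𝓙-suc k u

  𝓙-predict : ∀ k u {N α M β i γ} → 𝓙 k u (item N α (inj₁ M ∷ β) i k) → Rule M γ → 𝓙 k u (item M [] γ k k)
  𝓙-predict k u h R with 𝓙-is-π k u
  ... | _ , e = ≡⇒⊆ (sym e) (π-predict (≡⇒⊆ e h) R)

  𝓙-complete : ∀ k u {N α M β i j γ} → 𝓙 k u (item N α (inj₁ M ∷ β) i j) → 𝓙 k u (item M γ [] j k) →
               𝓙 k u (item N (α ++ [ inj₁ M ]) β i k)
  𝓙-complete k u h₁ h₂ with 𝓙-is-π k u
  ... | _ , e = ≡⇒⊆ (sym e) (π-complete (≡⇒⊆ e h₁) (≡⇒⊆ e h₂))

  𝓙-scan : ∀ k u {N α β i x} → 𝓙 k u (item N α (inj₂ (proj₁ x) ∷ β) i k) → 𝓣 k u x →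
           𝓙 k u (item N (α ++ [ inj₂ (proj₁ x) ]) β i (k + tlen x))
  𝓙-scan k u h t with 𝓙-is-π k u
  ... | _ , e = ≡⇒⊆ (sym e) (π-scan (≡⇒⊆ e h) t)

  𝓙-step : ∀ k {u} → 𝓙 k u ⊆ 𝓙 k (suc u)
  𝓙-step k {u} h = ≡⇒⊆ (sym (𝓙-suc k u)) (π-incl h)

  𝓙-mono : ∀ k {u v} → u ≤ v → 𝓙 k u ⊆ 𝓙 k v
  𝓙-mono k = chain-mono (𝓙-step k)

  𝓘-mono : ∀ {j k} → j ≤ k → 𝓘 j ⊆ 𝓘 k
  𝓘-mono = chain-mono {P = 𝓘} (λ h → 0 , π-incl h)

  𝓘⊆𝓙 : ∀ {j k} u → j < k → 𝓘 j ⊆ 𝓙 k u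
  𝓘⊆𝓙 {k = suc k} u (s≤s j≤k) h = 𝓙-mono (suc k) {0} {u} z≤n (π-incl (𝓘-mono j≤k h))

  𝓟-step : ∀ k {u} → 𝓟 k u ⊆ 𝓟 k (suc u)
  𝓟-step k {u} h = ≡⇒⊆ (sym (𝓟-suc k u)) (0 , h)

  𝓟-mono : ∀ k {u v} → u ≤ v → 𝓟 k u ⊆ 𝓟 k v
  𝓟-mono k = chain-mono (𝓟-step k)

  𝓟∞-mono : ∀ {j k} → j ≤ k → 𝓟∞ j ⊆ 𝓟∞ k
  𝓟∞-mono = chain-mono {P = 𝓟∞} (λ h → 0 , h)

  𝓟∞⊆𝓟 : ∀ {j k} u → j < k → 𝓟∞ j ⊆ 𝓟 k u
  𝓟∞⊆𝓟 {k = suc k} u (s≤s j≤k) h = 𝓟-mono (suc k) {0} {u} z≤n (𝓟∞-mono {k = k} j≤k h)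

  []∈𝓟 : ∀ k u → 𝓟 k u []
  []∈𝓟 zero    zero    = refl
  []∈𝓟 (suc k) zero    = 0 , []∈𝓟 k 0
  []∈𝓟 k       (suc u) = 𝓟-step k ([]∈𝓟 k u)

  𝓦-step : ∀ k {u} → 𝓦 k u ⊆ 𝓦 k (suc u)
  𝓦-step k (lexed , p , hp , e , lp) = lexed , p , 𝓟-step k hp , e , lp

  𝓩⊆𝓦 : ∀ k u → 𝓩 k u ⊆ 𝓦 k u
  𝓩⊆𝓦 k zero    ()
  𝓩⊆𝓦 k (suc u) h = 𝓦-step k (proj₂ (Sel-ok (𝓩 k u) (𝓦 k u) (𝓩⊆𝓦 k u)) h)

  𝓩-mono : ∀ k {u v} → u ≤ v → 𝓩 k u ⊆ 𝓩 k v
  𝓩-mono k = chain-mono (λ {u} → proj₁ (Sel-ok (𝓩 k u) (𝓦 k u) (𝓩⊆𝓦 k u)))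

  Candidates : ℕ → ℕ → Pred Tok 0ℓ
  Candidates k u x = ∃[ X ] ∃[ N ] ∃[ α ] ∃[ β ] ∃[ i ] (𝓙 k u (item N α (inj₂ X ∷ β) i k) × x ∈ Lex X D k)

  Candidates-step : ∀ k {u} → Candidates k u ⊆ Candidates k (suc u)
  Candidates-step k (X , N , α , β , i , h , lexed) = X , N , α , β , i , 𝓙-step k h , lexed

  𝓣⊆Candidates : ∀ k u → 𝓣 k u ⊆ Candidates k u
  𝓣⊆Candidates k zero    ()
  𝓣⊆Candidates k (suc u) h = Candidates-step k (proj₂ (Sel-ok (𝓣 k u) (Candidates k u) (𝓣⊆Candidates k u)) h)

  𝓣-mono : ∀ k {u v} → u ≤ v → 𝓣 k u ⊆ 𝓣 k v
  𝓣-mono k = chain-mono (λ {u} → proj₁ (Sel-ok (𝓣 k u) (Candidates k u) (𝓣⊆Candidates k u)))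

  Selected : ℕ → Tok → Set
  Selected j x = ∃[ v ] 𝓩 j v x

  -- The tokens a path of 𝓟 k u may use at position j.
  TokenOK : ℕ → ℕ → ℕ → Tok → Set
  TokenOK k u j x = (j < k × Selected j x) ⊎ (j ≡ k × 𝓩 k u x)

  TokenOK-step : ∀ k u {j x} → TokenOK k u j x → TokenOK k (suc u) j x
  TokenOK-step k u (inj₁ o)       = inj₁ o
  TokenOK-step k u (inj₂ (e , z)) = inj₂ (e , 𝓩-mono k (n≤1+n u) z)

  TokenOK-next : ∀ k v {j x} → TokenOK k v j x → TokenOK (suc k) 0 j x
  TokenOK-next k v (inj₁ (j<k , s)) = inj₁ (m<n⇒m<1+n j<k , s)
  TokenOK-next k v (inj₂ (refl , z)) = inj₁ (≤-refl , v , z)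

  TokenOK⇒Selected : ∀ {k u j x} → TokenOK k u j x → Selected j x
  TokenOK⇒Selected {u = u} (inj₁ (_ , s))    = s
  TokenOK⇒Selected {u = u} (inj₂ (refl , z)) = u , z

  PathOK : ℕ → ℕ → Path → Set
  PathOK k u p = AllAt (TokenOK k u) 0 p × Lprefix ⌊ p ⌋

  𝓟⊆PathOK : ∀ k u → 𝓟 k u ⊆ PathOK k u
  𝓟⊆PathOK zero    zero    refl    = [] , Lprefix-[]
  𝓟⊆PathOK (suc k) zero    (v , h) with 𝓟⊆PathOK k v h
  ... | ok , lp = AllAt-map (TokenOK-next k v) ok , lp
  𝓟⊆PathOK k       (suc u) h with ≡⇒⊆ (𝓟-suc k u) h
  ... | n , h′ = appended n h′
    where
    appended : ∀ n → iter (Append k (𝓩 k (suc u))) n (𝓟 k u) ⊆ PathOK k (suc u)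
    appended zero h with 𝓟⊆PathOK k u h
    ... | ok , lp = AllAt-map (TokenOK-step k u) ok , lp
    appended (suc n) (inj₁ h) = appended n h
    appended (suc n) (inj₂ (p , t , h , e , z , lp , refl)) =
      AllAt-++ p (proj₁ (appended n h)) (inj₂ (e , z) ∷ []) , lp

  𝓟-snoc : ∀ k u {p t} → 𝓟 k u p → len p ≡ k → 𝓩 k u t → Lprefix ⌊ p ∷ʳ t ⌋ → 𝓟 k u (p ∷ʳ t)
  𝓟-snoc k zero    _ _ ()
  𝓟-snoc k (suc u) {p} {t} h e z lp with ≡⇒⊆ (𝓟-suc k u) h
  ... | n , h′ = ≡⇒⊆ (sym (𝓟-suc k u)) (suc n , inj₂ (p , t , h′ , e , z , lp , refl))

  𝓟∞-snoc : ∀ {p t} → 𝓟∞ (len p) p → Selected (len p) t → Lprefix ⌊ p ∷ʳ t ⌋ → 𝓟∞ (len p) (p ∷ʳ t)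
  𝓟∞-snoc {p} (v , h) (w , z) lp =
    v + w , 𝓟-snoc (len p) (v + w) (𝓟-mono (len p) (m≤m+n v w) h) refl (𝓩-mono (len p) (m≤n+m w v) z) lp

  Selected⊆𝓟∞ : ∀ p {t} → Reverse p → AllAt Selected 0 (p ∷ʳ t) → Lprefix ⌊ p ∷ʳ t ⌋ → 𝓟∞ (len p) (p ∷ʳ t)
  Selected⊆𝓟∞ .[] [] (s ∷ []) lp = 𝓟∞-snoc {p = []} (0 , refl) s lp
  Selected⊆𝓟∞ .(p ∷ʳ t′) (p ∶ r ∶ʳ t′) sel lp with AllAt-++⁻ (p ∷ʳ t′) sel
  ... | sel′ , (s ∷ []) =
    𝓟∞-snoc (𝓟∞-mono (len-++-≤ p [ t′ ]) (Selected⊆𝓟∞ p r sel′ (Lprefix-∷ʳ⁻ (p ∷ʳ t′) _ lp)))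
            s lp

  PathOK⊆𝓟 : ∀ k u → PathOK k u ⊆ 𝓟 k u
  PathOK⊆𝓟 k u {p} = go p (reverseView p)
    where
    go : ∀ p → Reverse p → PathOK k u p → 𝓟 k u p
    go .[]       []          _         = []∈𝓟 k u
    go .(p ∷ʳ t) (p ∶ r ∶ʳ t) (ok , lp) with AllAt-++⁻ p ok
    ... | _   , (inj₁ (len<k , _) ∷ []) =
      𝓟∞⊆𝓟 u len<k (Selected⊆𝓟∞ p r (AllAt-map (TokenOK⇒Selected {k} {u}) ok) lp)
    ... | okp , (inj₂ (e , z) ∷ [])     = 𝓟-snoc k u (go p r (okp , Lprefix-∷ʳ⁻ p t lp)) e z lp

  ⇒*-advance : ∀ {p₁ p₂ N δ α Y β} → S₀ ⇒* (tsyms p₁ ++ inj₁ N ∷ δ) → Rule N (α ++ Y ∷ β) → α ⇒* tsyms p₂ →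
               S₀ ⇒* (tsyms (p₁ ++ p₂) ++ Y ∷ β ++ δ)
  ⇒*-advance {p₁} {p₂} {N} {δ} {α} {Y} {β} d₁ R d₂ =
    subst (S₀ ⇒*_) shape
      (d₁ ◅◅ ⇒*-++ˡ (tsyms p₁) (step [] N (α ++ Y ∷ β) δ R ◅
                                 subst (_⇒* _) (sym (++-assoc α (Y ∷ β) δ)) (⇒*-++ʳ (Y ∷ β ++ δ) d₂)))
    where
    shape : tsyms p₁ ++ tsyms p₂ ++ Y ∷ β ++ δ ≡ tsyms (p₁ ++ p₂) ++ Y ∷ β ++ δ
    shape = trans (sym (++-assoc (tsyms p₁) (tsyms p₂) _)) (cong (_++ Y ∷ β ++ δ) (sym (tsyms-++ p₁ p₂)))

  Valid : (ℕ → Tok → Set) → Item → Set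
  Valid P (item N α β i j) = Rule N (α ++ β) × ∃[ p₁ ] ∃[ p₂ ] ∃[ δ ]
    (AllAt P 0 (p₁ ++ p₂) × len p₁ ≡ i × len (p₁ ++ p₂) ≡ j
     × S₀ ⇒* (tsyms p₁ ++ inj₁ N ∷ δ) × α ⇒* tsyms p₂)

  Valid-map : ∀ {P Q : ℕ → Tok → Set} → (∀ {j x} → P j x → Q j x) → Valid P ⊆ Valid Q
  Valid-map f (R , p₁ , p₂ , δ , ok , e₁ , e₂ , d₁ , d₂) =
    R , p₁ , p₂ , δ , AllAt-map f ok , e₁ , e₂ , d₁ , d₂

  Valid-init : ∀ {P} → Init ⊆ Valid P
  Valid-init (γ , R , refl) = R , [] , [] , [] , [] , refl , refl , ε , ε

  Valid-predict : ∀ {P N α M β i j γ} → Valid P (item N α (inj₁ M ∷ β) i j) → Rule M γ → Valid P (item M [] γ j j)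
  Valid-predict {P} {α = α} (R , p₁ , p₂ , δ , ok , e₁ , e₂ , d₁ , d₂) R′ =
    R′ , p₁ ++ p₂ , [] , _ ,
    subst (AllAt P 0) (sym (++-identityʳ (p₁ ++ p₂))) ok , e₂ ,
    trans (cong len (++-identityʳ (p₁ ++ p₂))) e₂ , ⇒*-advance {p₁} {p₂} d₁ R d₂ , ε

  Valid-complete : ∀ {P N α M β i j k γ} → Valid P (item N α (inj₁ M ∷ β) i j) → Valid P (item M γ [] j k) →
                   Valid P (item N (α ++ [ inj₁ M ]) β i k)
  Valid-complete {P} {N} {α} {M} {β} {i} {j} {k} {γ}
                 (R , p₁ , p₂ , δ , ok , e₁ , e₂ , d₁ , d₂) (R′ , q₁ , q₂ , _ , ok′ , f₁ , f₂ , _ , d₃) =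
    subst (Rule N) (sym (++-assoc α [ inj₁ M ] β)) R , p₁ , p₂ ++ q₂ , δ ,
    subst (AllAt P 0) (++-assoc p₁ p₂ q₂)
      (AllAt-++ (p₁ ++ p₂) ok
        (subst (λ j′ → AllAt P j′ q₂) (trans f₁ (sym e₂)) (proj₂ (AllAt-++⁻ q₁ ok′)))) ,
    e₁ , spans ,
    d₁ ,
    subst (_ ⇒*_) (sym (tsyms-++ p₂ q₂)) (⇒*-++ d₂ (⇒*-rule (subst (Rule M) (++-identityʳ γ) R′) ◅◅ d₃))
    where
    open ≡-Reasoning
    spans : len (p₁ ++ p₂ ++ q₂) ≡ k
    spans = begin
      len (p₁ ++ p₂ ++ q₂)     ≡⟨ cong len (sym (++-assoc p₁ p₂ q₂)) ⟩
      len ((p₁ ++ p₂) ++ q₂)   ≡⟨ len-++ (p₁ ++ p₂) q₂ ⟩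
      len (p₁ ++ p₂) + len q₂  ≡⟨ cong (_+ len q₂) (trans e₂ (sym f₁)) ⟩
      len q₁ + len q₂          ≡⟨ sym (len-++ q₁ q₂) ⟩
      len (q₁ ++ q₂)           ≡⟨ f₂ ⟩
      k                        ∎

  Valid-scan : ∀ {P N α β i k x} → Valid P (item N α (inj₂ (proj₁ x) ∷ β) i k) → P k x →
               Valid P (item N (α ++ [ inj₂ (proj₁ x) ]) β i (k + tlen x))
  Valid-scan {P} {N} {α} {β} {i} {k} {x} (R , p₁ , p₂ , δ , ok , e₁ , e₂ , d₁ , d₂) o =
    subst (Rule N) (sym (++-assoc α [ inj₂ (proj₁ x) ] β)) R , p₁ , p₂ ∷ʳ x , δ ,
    subst (AllAt P 0) (++-assoc p₁ p₂ [ x ]) (AllAt-++ (p₁ ++ p₂) ok (subst (λ j → P j x) (sym e₂) o ∷ [])) ,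
    e₁ ,
    trans (cong len (sym (++-assoc p₁ p₂ [ x ])))
      (trans (len-++ (p₁ ++ p₂) [ x ]) (cong₂ _+_ e₂ (trans (length-++ (proj₂ x)) (+-identityʳ (tlen x))))) ,
    d₁ , subst (_ ⇒*_) (sym (tsyms-++ p₂ [ x ])) (⇒*-++ʳ _ d₂)

  π-Valid : ∀ {P k T I} → I ⊆ Valid P → T ⊆ P k → π k T I ⊆ Valid P
  π-Valid {P} {k} {T} {I} I-valid T-ok (n , h) = go n h
    where
    go  : ∀ n → iter (πstep k T) n I ⊆ Valid P
    goP : ∀ n → Predict k (iter (πstep k T) n I) ⊆ Valid P
    goC : ∀ n → Complete k (Predict k (iter (πstep k T) n I)) ⊆ Valid P
    go zero    h = I-valid h
    go (suc n) (inj₁ h) = goC n h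
    go (suc n) (inj₂ (X , c , _ , _ , _ , _ , t , h , refl)) = Valid-scan {x = X , c} (goC n h) (T-ok t)
    goC n (inj₁ h) = goP n h
    goC n (inj₂ (_ , _ , _ , _ , _ , _ , _ , h₁ , h₂ , refl)) = Valid-complete (goP n h₁) (goP n h₂)
    goP n (inj₁ h) = go n h
    goP n (inj₂ (_ , _ , _ , _ , _ , _ , h , R , refl)) = Valid-predict (go n h) R

  TokensAgree : ℕ → ℕ → Set
  TokensAgree k u = ∀ x → 𝓣 k u x ⇔ 𝓩 k u x

  AgreeBelow : ℕ → Set
  AgreeBelow k = ∀ j v → j < k → TokensAgree j v

  𝓙-valid : ∀ k u → AgreeBelow k → (∀ v → v ≤ u → TokensAgree k v) → 𝓙 k u ⊆ Valid (TokenOK k u)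
  𝓙-valid zero    zero    _     _    = π-Valid Valid-init (λ ())
  𝓙-valid (suc k) zero    below _    = π-Valid earlier (λ ())
    where
    earlier : 𝓘 k ⊆ Valid (TokenOK (suc k) 0)
    earlier (v , h) = Valid-map (TokenOK-next k v)
      (𝓙-valid k v (λ j w j<k → below j w (m<n⇒m<1+n j<k)) (λ w _ → below k w ≤-refl) h)
  𝓙-valid k       (suc u) below upto h =
    π-Valid (Valid-map (TokenOK-step k u) ∘ 𝓙-valid k u below (λ v v≤u → upto v (m≤n⇒m≤1+n v≤u)))
            (λ {t} z → inj₂ (refl , Equivalence.to (upto (suc u) ≤-refl t) z))
            (≡⇒⊆ (𝓙-suc k u) h)

  module Completeness (k u : ℕ) (below : AgreeBelow k) (agree : TokensAgree k u) where

    Reached : ℕ → Item → Set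
    Reached j x = (j < k × 𝓘 j x) ⊎ (k ≤ j × 𝓙 k u x)

    Reached-cast : ∀ {N α α′ β β′ i j j′} → α ≡ α′ → β ≡ β′ → j ≡ j′ →
                   Reached j (item N α β i j) → Reached j′ (item N α′ β′ i j′)
    Reached-cast refl refl refl h = h

    Reached-mono : ∀ {j j′ x} → j ≤ j′ → Reached j x → Reached j′ x
    Reached-mono {j′ = j′} j≤j′ (inj₁ (j<k , h)) with j′ <? k
    ... | yes j′<k = inj₁ (j′<k , 𝓘-mono j≤j′ h)
    ... | no  j′≮k = inj₂ (≮⇒≥ j′≮k , 𝓘⊆𝓙 u j<k h)
    Reached-mono j≤j′ (inj₂ (k≤j , h)) = inj₂ (≤-trans k≤j j≤j′ , h)

    Reached-init : ∀ {x} → Init x → Reached 0 x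
    Reached-init {x} h with 0 <? k
    ... | yes 0<k = inj₁ (0<k , 0 , π-incl h)
    ... | no  0≮k = inj₂ (≮⇒≥ 0≮k , subst (λ k′ → 𝓙 k′ u x) (sym k≡0) (𝓙-mono 0 {0} {u} z≤n (π-incl h)))
      where
      k≡0 : k ≡ 0
      k≡0 = n≤0⇒n≡0 (≮⇒≥ 0≮k)

    Reached-final : ∀ {x} → Reached k x → 𝓙 k u x
    Reached-final (inj₁ (k<k , _)) = ⊥-elim (<-irrefl refl k<k)
    Reached-final (inj₂ (_ , h))   = h

    Reached-predict : ∀ {N α M β i j γ} → j ≤ k → Reached j (item N α (inj₁ M ∷ β) i j) → Rule M γ →
                      Reached j (item M [] γ j j)
    Reached-predict {j = j} _ (inj₁ (j<k , v , h)) R = inj₁ (j<k , v , 𝓙-predict j v h R)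
    Reached-predict j≤k (inj₂ (k≤j , h)) R with ≤-antisym j≤k k≤j
    ... | refl = inj₂ (k≤j , 𝓙-predict k u h R)

    Reached-complete : ∀ {N α M β i j j′ γ} → j ≤ j′ → j′ ≤ k →
                       Reached j (item N α (inj₁ M ∷ β) i j) → Reached j′ (item M γ [] j j′) →
                       Reached j′ (item N (α ++ [ inj₁ M ]) β i j′)
    Reached-complete {j′ = j′} j≤j′ j′≤k h₁ h₂ with Reached-mono j≤j′ h₁ | h₂
    ... | inj₁ (j′<k , v , a) | inj₁ (_ , w , b) =
      inj₁ (j′<k , v + w , 𝓙-complete j′ (v + w) (𝓙-mono j′ (m≤m+n v w) a) (𝓙-mono j′ (m≤n+m w v) b))
    ... | inj₁ (j′<k , _) | inj₂ (k≤j′ , _) = ⊥-elim (<⇒≱ j′<k k≤j′)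
    ... | inj₂ (k≤j′ , _) | inj₁ (j′<k , _) = ⊥-elim (<⇒≱ j′<k k≤j′)
    ... | inj₂ (k≤j′ , a) | inj₂ (_ , b) with ≤-antisym j′≤k k≤j′
    ...   | refl = inj₂ (k≤j′ , 𝓙-complete k u a b)

    Reached-scan : ∀ {N α β i j x} → Reached j (item N α (inj₂ (proj₁ x) ∷ β) i j) → TokenOK k u j x →
                   Reached (j + tlen x) (item N (α ++ [ inj₂ (proj₁ x) ]) β i (j + tlen x))
    Reached-scan {j = j} {x} (inj₁ (_ , v , h)) (inj₁ (j<k , w , z)) =
      Reached-mono (m≤m+n j (tlen x))
        (inj₁ (j<k , v + w , 𝓙-scan j (v + w) (𝓙-mono j (m≤m+n v w) h)
                                    (𝓣-mono j (m≤n+m w v) (Equivalence.from (below j w j<k x) z))))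
    Reached-scan (inj₂ (k≤j , _)) (inj₁ (j<k , _))  = ⊥-elim (<⇒≱ j<k k≤j)
    Reached-scan (inj₁ (k<k , _)) (inj₂ (refl , _)) = ⊥-elim (<-irrefl refl k<k)
    Reached-scan {x = x} (inj₂ (_ , h)) (inj₂ (refl , z)) =
      inj₂ (m≤m+n k (tlen x) , 𝓙-scan k u h (Equivalence.from (agree x) z))

    walk-Parse : ∀ {β₁ q} → Parse β₁ q → ∀ {N α β₂ i j} → Reached j (item N α (β₁ ++ β₂) i j) →
                 AllAt (TokenOK k u) j q → j + len q ≤ k →
                 Reached (j + len q) (item N (α ++ β₁) β₂ i (j + len q))
    walk-Parse [] {α = α} {j = j} h [] _ = Reached-cast (sym (++-identityʳ α)) refl (sym (+-identityʳ j)) h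
    walk-Parse (term {β} {x} {q} d) {α = α} {j = j} h (o ∷ ok) b =
      Reached-cast (++-assoc α [ inj₂ (proj₁ x) ] β) refl (sym (+len-∷ j x q))
        (walk-Parse d (Reached-scan h o) ok (subst (_≤ k) (+len-∷ j x q) b))
    walk-Parse (nonterm {N′} {ρ} {β} {q₁} {q₂} R d₁ d₂) {α = α} {j = j} h ok b with AllAt-++⁻ q₁ ok
    ... | ok₁ , ok₂ =
      Reached-cast (++-assoc α [ inj₁ N′ ] β) refl (sym (+len-++ j q₁ q₂))
        (walk-Parse d₂ (Reached-complete (m≤m+n j (len q₁)) b₁ h child) ok₂ (subst (_≤ k) (+len-++ j q₁ q₂) b))
      where
      b₁ : j + len q₁ ≤ k
      b₁ = ≤-trans (m≤m+n (j + len q₁) (len q₂)) (subst (_≤ k) (+len-++ j q₁ q₂) b)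
      child : Reached (j + len q₁) (item N′ ρ [] j (j + len q₁))
      child = walk-Parse d₁ (Reached-cast refl (sym (++-identityʳ ρ)) refl
                              (Reached-predict (≤-trans (m≤m+n j _) b) h R)) ok₁ b₁

    Expects : ℕ → Sym → Set
    Expects j Y = ∃[ K ] ∃[ α ] ∃[ β ] ∃[ i ] Reached j (item K α (Y ∷ β) i j)

    walk-ParseUntil : ∀ {β q Y} → ParseUntil β q Y → ∀ {N α β₂ i j} → Reached j (item N α (β ++ β₂) i j) →
                      AllAt (TokenOK k u) j q → j + len q ≤ k → Expects (j + len q) Y
    walk-ParseUntil (here {β₁} {β₃} {Y = Y} d) {N} {α} {β₂} {i} h ok b =
      N , α ++ β₁ , β₃ ++ β₂ , i , walk-Parse d (Reached-cast refl (++-assoc β₁ (Y ∷ β₃) β₂) refl h) ok b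
    walk-ParseUntil (deep {β₁} {β₃} {K} {ρ} {q₁} {q₂} {Y} d R u′) {α = α} {β₂ = β₂} {j = j} h ok b
      with AllAt-++⁻ q₁ ok
    ... | ok₁ , ok₂ =
      subst (λ j′ → Expects j′ Y) (sym (+len-++ j q₁ q₂))
        (walk-ParseUntil u′ predicted ok₂ (subst (_≤ k) (+len-++ j q₁ q₂) b))
      where
      b₁ : j + len q₁ ≤ k
      b₁ = ≤-trans (m≤m+n (j + len q₁) (len q₂)) (subst (_≤ k) (+len-++ j q₁ q₂) b)
      before : Reached (j + len q₁) (item _ (α ++ β₁) (inj₁ K ∷ β₃ ++ β₂) _ (j + len q₁))
      before = walk-Parse d (Reached-cast refl (++-assoc β₁ (inj₁ K ∷ β₃) β₂) refl h) ok₁ b₁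
      predicted : Reached (j + len q₁) (item K [] (ρ ++ []) (j + len q₁) (j + len q₁))
      predicted = Reached-cast refl (sym (++-identityʳ ρ)) refl (Reached-predict b₁ before R)

    Reached-start : ∀ {ρ} → Rule Start ρ → Reached 0 (item Start [] (ρ ++ []) 0 0)
    Reached-start {ρ} R = Reached-init (ρ ++ [] , subst (Rule Start) (sym (++-identityʳ ρ)) R , refl)

    scannable : ∀ {x p} → AllAt (TokenOK k u) 0 p → len p ≡ k → Lprefix ⌊ p ∷ʳ x ⌋ →
                ∃[ N ] ∃[ α ] ∃[ β ] ∃[ i ] 𝓙 k u (item N α (inj₂ (proj₁ x) ∷ β) i k)
    scannable {x} {p} ok e (γ , d)
      with start-ParseUntil (⇒*⇒Forest d) p (proj₁ x) γ
             (trans (cong (_++ γ) (tsyms-++ p [ x ])) (++-assoc (tsyms p) _ γ))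
    ... | ρ , R , parse with walk-ParseUntil parse (Reached-start R) ok (≤-reflexive e)
    ... | N , α , β , i , h = N , α , β , i , Reached-final (subst (λ j → Reached j (item N α _ i j)) e h)

    accepted : ∀ {p} → AllAt (TokenOK k u) 0 p → len p ≡ k → L ⌊ p ⌋ → ∃[ α ] 𝓙 k u (item Start α [] 0 k)
    accepted {p} ok e d with start-Parse (⇒*⇒Forest d) p refl
    ... | ρ , R , parse =
      ρ , Reached-final (subst (λ j → Reached j (item Start ρ [] 0 j)) e
                          (walk-Parse parse (Reached-start R) ok (≤-reflexive e)))

  Candidates⇔𝓦 : ∀ k u → AgreeBelow k → (∀ v → v ≤ u → TokensAgree k v) → ∀ x → Candidates k u x ⇔ 𝓦 k u x
  Candidates⇔𝓦 k u below upto x = mk⇔ to from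
    where
    to : Candidates k u x → 𝓦 k u x
    to (X , N , α , β , i , h , lexed) with 𝓙-valid k u below upto h | proj₁ (Lex-ok X D k x lexed)
    ... | R , p₁ , p₂ , δ , ok , _ , e₂ , d₁ , d₂ | refl =
      lexed , p₁ ++ p₂ , PathOK⊆𝓟 k u (ok , Lprefix-∷ʳ⁻ (p₁ ++ p₂) x lp) , e₂ , lp
      where
      lp : Lprefix ⌊ (p₁ ++ p₂) ∷ʳ x ⌋
      lp = β ++ δ , subst (S₀ ⇒*_)
             (sym (trans (cong (_++ β ++ δ) (tsyms-++ (p₁ ++ p₂) [ x ])) (++-assoc (tsyms (p₁ ++ p₂)) _ (β ++ δ))))
             (⇒*-advance {p₁} {p₂} d₁ R d₂)
    from : 𝓦 k u x → Candidates k u x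
    from (lexed , p , hp , e , lp)
      with Completeness.scannable k u below (upto u ≤-refl) (proj₁ (𝓟⊆PathOK k u hp)) e lp
    ... | N , α , β , i , h = proj₁ x , N , α , β , i , h , lexed

  agree-suc : ∀ k u → AgreeBelow k → (∀ v → v ≤ u → TokensAgree k v) → TokensAgree k (suc u)
  agree-suc k u below upto =
    Sel-ext (𝓣 k u) (𝓩 k u) (Candidates k u) (𝓦 k u) (upto u ≤-refl) (Candidates⇔𝓦 k u below upto)

  agree-upTo : ∀ k → AgreeBelow k → ∀ u v → v ≤ u → TokensAgree k v
  agree-upTo k below u       zero    _         x = mk⇔ (λ ()) (λ ())
  agree-upTo k below (suc u) (suc v) (s≤s v≤u) =
    agree-suc k v below (λ w w≤v → agree-upTo k below u w (≤-trans w≤v v≤u))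

  agree-below : ∀ k → AgreeBelow k
  agree-below (suc k) j v (s≤s j≤k) with m≤n⇒m<n∨m≡n j≤k
  ... | inj₁ j<k  = agree-below k j v j<k
  ... | inj₂ refl = agree-upTo k (agree-below k) v v ≤-refl

  agree : ∀ k u → TokensAgree k u
  agree k u = agree-upTo k (agree-below k) u u ≤-refl

  Earley-complete : InCharLang → ∃[ α ] 𝔍 (item Start α [] 0 (length D))
  Earley-complete (p , (u , hp) , e , d)
    with Completeness.accepted (length D) u (agree-below _) (agree _ u) (proj₁ (𝓟⊆PathOK _ u hp)) e d
  ... | α , h = α , u , h

  Earley-sound : ∃[ α ] 𝔍 (item Start α [] 0 (length D)) → InCharLang
  Earley-sound (α , u , h) with 𝓙-valid (length D) u (agree-below _) (λ v _ → agree _ v) h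
  ... | R , p₁ , p₂ , _ , ok , e₁ , e₂ , _ , d₂ =
    p₂ , (u , PathOK⊆𝓟 _ u (ok₂ , [] , subst (S₀ ⇒*_) (sym (++-identityʳ _)) derivation)) , spans , derivation
    where
    ok₂ : AllAt (TokenOK (length D) u) 0 p₂
    ok₂ = subst (λ j → AllAt _ j p₂) e₁ (proj₂ (AllAt-++⁻ p₁ ok))
    derivation : S₀ ⇒* tsyms p₂
    derivation = ⇒*-rule (subst (Rule Start) (++-identityʳ α) R) ◅◅ d₂
    spans : len p₂ ≡ length D
    spans = trans (cong (_+ len p₂) (sym e₁)) (trans (sym (len-++ p₁ p₂)) e₂)

theorem2 : {Ch : Set} (G : Grammar) (LL : LocalLexing (Grammar.Te G) Ch) (D : List Ch) →
    LocalLexingSemantics.InCharLang G LL D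
    ⇔ (∃[ α ] LocalLexingSemantics.𝔍 G LL D
    (LocalLexingSemantics.item (Grammar.Start G) α [] 0 (length D)))
theorem2 G LL D = mk⇔ Earley-complete Earley-sound
  where open Correctness G LL D
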